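{- For a positive integer $m$, write $m=\binom{k_1}{2}+\cdots+\binom{k_r}{2}$ with $k_1\ge\cdots\ge k_r\ge2$, where $k_1,k_2,\dots$ are chosen successively (greedily) as large as possible subject to $m-\binom{k_1}{2}-\cdots-\binom{k_i}{2}\ge0$ for all $1\le i\le r$, and set $\nu(m)=k_1+\cdots+k_r$. For $n\ge1$ let $H(n)$ be the largest integer $N$ such that $\nu(m)\le n$ for every positive integer $m\le N$. Then there is a constant $c>0$ such that $H(n)\ge \frac{n^2}{2}-cn^{3/2}$ for all $n\ge1$. -}

module Defs where

open import Data.Nat using (ℕ; zero; suc; _+_; _*_; _∸_; _^_; _≤_; _<_; _≤?_)
open import Data.Nat.Combinatorics using (_C_)
open import Relation.Nullary using (yes; no)

largestKUpTo : ℕ → ℕ → ℕ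
largestKUpTo m zero = zero
largestKUpTo m (suc j) with (suc j C 2) ≤? m
... | yes _ = suc j
... | no  _ = largestKUpTo m j

-- largest k with (k C 2) ≤ m.  Since (m+2 C 2) > m, searching k ≤ m+1 suffices;
-- for m ≥ 1 the result is ≥ 2.
largestK : ℕ → ℕ
largestK m = largestKUpTo m (suc m)

-- greedy: ν(m) = k₁ + ν(m - (k₁ C 2)) with k₁ = largestK m, ν(0) = 0.
-- Each step decreases m by at least 1, so fuel m suffices.
νFuel : ℕ → ℕ → ℕ
νFuel zero    m       = zero
νFuel (suc f) zero    = zero
νFuel (suc f) (suc m) = largestK (suc m) + νFuel f (suc m ∸ (largestK (suc m) C 2))

ν : ℕ → ℕ
ν m = νFuel m m

AllGood : ℕ → ℕ → Set
AllGood n N = ∀ m → 1 ≤ m → m ≤ N → ν m ≤ n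

IsH : ℕ → ℕ → Set
IsH n N = AllGood n N × (∀ N′ → AllGood n N′ → N′ ≤ N)
  where open import Data.Product using (_×_)

{-# OPTIONS --safe #-}
module Submission where

open import Defs
open import Data.Nat using (ℕ; zero; suc; pred; _+_; _*_; _∸_; _^_; _≤_; _<_; _≤?_; _<?_; z≤n; s≤s; s≤s⁻¹)
open import Data.Nat.Properties
open import Data.Nat.Combinatorics using (_C_; nC1≡n; nCk+nC[k+1]≡[n+1]C[k+1])
open import Data.Nat.Tactic.RingSolver using (solve-∀)
open import Data.Product using (∃; ∃-syntax; _×_; _,_)
open import Data.Sum using (inj₁; inj₂)
open import Data.Empty using (⊥-elim)
open import Relation.Nullary using (yes; no)
open import Relation.Binary.PropositionalEquality

-- Write K = n ∸ 3L with L = 2(⌊√n⌋ + 1). Greedy splits any m below (K+1 choose 2)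
-- into a first part k ≤ K and a remainder r < k. Since every greedy part k
-- satisfies k ≤ 2 (k choose 2), ν x ≤ 2x; applying this to the remainder of r
-- gives ν r ≤ 3 · (largest part of r) ≤ 3L, because r < K < (L+1 choose 2).
-- So ν m ≤ K + 3L = n, whence 2 H(n) ≥ K² − 2 and n² − 2 H(n) ≤ 2 + 12 n (⌊√n⌋ + 1),
-- which is O(n^{3/2}).

[1+n]C2≡n+nC2 : ∀ n → suc n C 2 ≡ n + n C 2
[1+n]C2≡n+nC2 n = trans (sym (nCk+nC[k+1]≡[n+1]C[k+1] n 1)) (cong (_+ n C 2) (nC1≡n n))

2*nC2≡n*pred[n] : ∀ n → 2 * (n C 2) ≡ n * pred n
2*nC2≡n*pred[n] zero = refl
2*nC2≡n*pred[n] (suc zero) = refl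
2*nC2≡n*pred[n] (suc (suc n)) = begin
  2 * (suc (suc n) C 2)         ≡⟨ cong (2 *_) ([1+n]C2≡n+nC2 (suc n)) ⟩
  2 * (suc n + suc n C 2)       ≡⟨ *-distribˡ-+ 2 (suc n) (suc n C 2) ⟩
  2 * suc n + 2 * (suc n C 2)   ≡⟨ cong (2 * suc n +_) (2*nC2≡n*pred[n] (suc n)) ⟩
  2 * suc n + suc n * n         ≡⟨ ring n ⟩
  suc (suc n) * suc n           ∎
  where
  open ≡-Reasoning
  ring : ∀ n → 2 * suc n + suc n * n ≡ suc (suc n) * suc n
  ring = solve-∀

C2-mono-≤ : ∀ {m n} → m ≤ n → m C 2 ≤ n C 2
C2-mono-≤ {m} {n} m≤n = *-cancelˡ-≤ 2 (begin
  2 * (m C 2)  ≡⟨ 2*nC2≡n*pred[n] m ⟩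
  m * pred m   ≤⟨ *-mono-≤ m≤n (pred-mono-≤ m≤n) ⟩
  n * pred n   ≡⟨ 2*nC2≡n*pred[n] n ⟨
  2 * (n C 2)  ∎)
  where open ≤-Reasoning

n≤2*nC2 : ∀ {n} → 2 ≤ n → n ≤ 2 * (n C 2)
n≤2*nC2 {suc zero} (s≤s ())
n≤2*nC2 {n@(suc (suc k))} _ = subst (n ≤_) (sym (2*nC2≡n*pred[n] n)) (m≤m*n n (suc k))

n*n≤[1+2*n]C2 : ∀ n → n * n ≤ suc (2 * n) C 2
n*n≤[1+2*n]C2 n = *-cancelˡ-≤ 2 (begin
  2 * (n * n)                    ≤⟨ m≤m+n (2 * (n * n)) (2 * (n * n + n)) ⟩
  2 * (n * n) + 2 * (n * n + n)  ≡⟨ ring n ⟩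
  suc (2 * n) * (2 * n)          ≡⟨ 2*nC2≡n*pred[n] (suc (2 * n)) ⟨
  2 * (suc (2 * n) C 2)          ∎)
  where
  open ≤-Reasoning
  ring : ∀ n → 2 * (n * n) + 2 * (n * n + n) ≡ suc (2 * n) * (2 * n)
  ring = solve-∀

largestKUpTo-C2≤ : ∀ m j → largestKUpTo m j C 2 ≤ m
largestKUpTo-C2≤ m zero = z≤n
largestKUpTo-C2≤ m (suc j) with suc j C 2 ≤? m
... | yes jC2≤m = jC2≤m
... | no  _     = largestKUpTo-C2≤ m j

largestKUpTo-maximal : ∀ m j {k} → largestKUpTo m j < k → k ≤ j → m < k C 2
largestKUpTo-maximal m zero () z≤n
largestKUpTo-maximal m (suc j) lt k≤1+j with suc j C 2 ≤? m
... | yes _     = ⊥-elim (<⇒≱ lt k≤1+j)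
... | no  jC2≰m with m≤n⇒m<n∨m≡n k≤1+j
...   | inj₁ k<1+j = largestKUpTo-maximal m j lt (s≤s⁻¹ k<1+j)
...   | inj₂ refl  = ≰⇒> jC2≰m

largestK-C2≤ : ∀ m → largestK m C 2 ≤ m
largestK-C2≤ m = largestKUpTo-C2≤ m (suc m)

<[1+largestK]C2 : ∀ m → m < suc (largestK m) C 2
<[1+largestK]C2 m with suc (largestK m) ≤? suc m
... | yes k≤1+m = largestKUpTo-maximal m (suc m) ≤-refl k≤1+m
... | no  k≰1+m = <-≤-trans m<[2+m]C2 (C2-mono-≤ (≰⇒> k≰1+m))
  where
  m<[2+m]C2 : m < suc (suc m) C 2
  m<[2+m]C2 = subst (m <_) (sym ([1+n]C2≡n+nC2 (suc m))) (s≤s (m≤m+n m _))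

<C2⇒largestK< : ∀ {m k} → m < k C 2 → largestK m < k
<C2⇒largestK< {m} {k} m<kC2 with largestK m <? k
... | yes l<k = l<k
... | no  l≮k = ⊥-elim (<⇒≱ m<kC2 (≤-trans (C2-mono-≤ (≮⇒≥ l≮k)) (largestK-C2≤ m)))

2≤largestK : ∀ {m} → 1 ≤ m → 2 ≤ largestK m
2≤largestK {m} 1≤m with 2 ≤? largestK m
... | yes 2≤l = 2≤l
... | no  2≰l = ⊥-elim (<⇒≱ (largestKUpTo-maximal m (suc m) (≰⇒> 2≰l) (s≤s 1≤m)) 1≤m)

greedyRest : ℕ → ℕ
greedyRest m = m ∸ largestK m C 2

greedyRest<largestK : ∀ m → greedyRest m < largestK m
greedyRest<largestK m = +-cancelʳ-< _ _ _ (begin-strict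
  greedyRest m + largestK m C 2  ≡⟨ m∸n+n≡m (largestK-C2≤ m) ⟩
  m                              <⟨ <[1+largestK]C2 m ⟩
  suc (largestK m) C 2           ≡⟨ [1+n]C2≡n+nC2 (largestK m) ⟩
  largestK m + largestK m C 2    ∎)
  where open ≤-Reasoning

greedyRest-suc≤ : ∀ m → greedyRest (suc m) ≤ m
greedyRest-suc≤ m = ∸-monoʳ-≤ (suc m) (C2-mono-≤ (2≤largestK {suc m} (s≤s z≤n)))

νFuel-irrelevant : ∀ {f g m} → m ≤ f → m ≤ g → νFuel f m ≡ νFuel g m
νFuel-irrelevant {zero}  {zero}  z≤n z≤n = refl
νFuel-irrelevant {zero}  {suc g} z≤n _   = refl
νFuel-irrelevant {suc f} {zero}  z≤n _   = refl
νFuel-irrelevant {suc f} {suc g} {zero} _ _ = refl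
νFuel-irrelevant {suc f} {suc g} {suc m} (s≤s m≤f) (s≤s m≤g) =
  cong (largestK (suc m) +_)
    (νFuel-irrelevant (≤-trans (greedyRest-suc≤ m) m≤f) (≤-trans (greedyRest-suc≤ m) m≤g))

ν-suc : ∀ m → ν (suc m) ≡ largestK (suc m) + ν (greedyRest (suc m))
ν-suc m = cong (largestK (suc m) +_) (νFuel-irrelevant (greedyRest-suc≤ m) ≤-refl)

νFuel≤2* : ∀ f m → νFuel f m ≤ 2 * m
νFuel≤2* zero    m       = z≤n
νFuel≤2* (suc f) zero    = z≤n
νFuel≤2* (suc f) (suc m) = begin
  k + νFuel f r         ≤⟨ +-mono-≤ (n≤2*nC2 (2≤largestK {suc m} (s≤s z≤n))) (νFuel≤2* f r) ⟩
  2 * (k C 2) + 2 * r   ≡⟨ *-distribˡ-+ 2 (k C 2) r ⟨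
  2 * (k C 2 + r)       ≡⟨ cong (2 *_) (m+[n∸m]≡n (largestK-C2≤ (suc m))) ⟩
  2 * suc m             ∎
  where
  open ≤-Reasoning
  k = largestK (suc m)
  r = greedyRest (suc m)

ν≤2* : ∀ m → ν m ≤ 2 * m
ν≤2* m = νFuel≤2* m m

ν≤3*largestK : ∀ m → ν m ≤ 3 * largestK m
ν≤3*largestK zero    = z≤n
ν≤3*largestK (suc m) = begin
  ν (suc m)    ≡⟨ ν-suc m ⟩
  k + ν r      ≤⟨ +-monoʳ-≤ k (≤-trans (ν≤2* r) (*-monoʳ-≤ 2 (<⇒≤ (greedyRest<largestK (suc m))))) ⟩
  k + 2 * k    ≡⟨ ring k ⟩
  3 * k        ∎
  where
  open ≤-Reasoning
  k = largestK (suc m)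
  r = greedyRest (suc m)
  ring : ∀ k → k + 2 * k ≡ 3 * k
  ring = solve-∀

ν≤K+3*L : ∀ {m K L} → m < suc K C 2 → K < suc L C 2 → ν m ≤ K + 3 * L
ν≤K+3*L {zero}          _        _ = z≤n
ν≤K+3*L {suc m} {K} {L} m<KC2 K<LC2 = begin
  ν (suc m)                 ≡⟨ ν-suc m ⟩
  k + ν r                   ≤⟨ +-monoʳ-≤ k (ν≤3*largestK r) ⟩
  k + 3 * largestK r        ≤⟨ +-mono-≤ k≤K (*-monoʳ-≤ 3 (s≤s⁻¹ (<C2⇒largestK< {r} {suc L} r<LC2))) ⟩
  K + 3 * L                 ∎
  where
  open ≤-Reasoning
  k = largestK (suc m)
  r = greedyRest (suc m)
  k≤K : k ≤ K
  k≤K = s≤s⁻¹ (<C2⇒largestK< m<KC2)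
  r<LC2 : r < suc L C 2
  r<LC2 = <-trans (<-≤-trans (greedyRest<largestK (suc m)) k≤K) K<LC2

allGood-[1+n∸3*L]C2∸1 : ∀ n L → n ∸ 3 * L < suc L C 2 → AllGood n (suc (n ∸ 3 * L) C 2 ∸ 1)
allGood-[1+n∸3*L]C2∸1 n L K<LC2 m 1≤m m≤ = begin
  ν m                ≤⟨ ν≤K+3*L {m} {n ∸ 3 * L} {L} m<KC2 K<LC2 ⟩
  n ∸ 3 * L + 3 * L  ≡⟨ m∸n+n≡m {n} {3 * L} (<⇒≤ (m∸n≢0⇒n<m {n} {3 * L} K≢0)) ⟩
  n                  ∎
  where
  open ≤-Reasoning
  ≤∸1⇒< : ∀ {x} → m ≤ x ∸ 1 → m < x
  ≤∸1⇒< {zero}  m≤0 = ⊥-elim (<⇒≱ 1≤m m≤0)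
  ≤∸1⇒< {suc _} m≤x = s≤s m≤x
  m<KC2 : m < suc (n ∸ 3 * L) C 2
  m<KC2 = ≤∸1⇒< m≤
  -- as 1 C 2 = 0, m ≥ 1 forces n ∸ 3 * L ≠ 0, so this truncated subtraction is exact
  K≢0 : n ∸ 3 * L ≢ 0
  K≢0 K≡0 = n≮0 (subst (λ K → m < suc K C 2) K≡0 m<KC2)

[1+k]C2∸1≤n⇒k*k≤2*[1+n] : ∀ {k n} → suc k C 2 ∸ 1 ≤ n → k * k ≤ 2 * suc n
[1+k]C2∸1≤n⇒k*k≤2*[1+n] {k} {n} kC2∸1≤n = begin
  k * k            ≤⟨ *-monoˡ-≤ k (n≤1+n k) ⟩
  suc k * k        ≡⟨ 2*nC2≡n*pred[n] (suc k) ⟨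
  2 * (suc k C 2)  ≤⟨ *-monoʳ-≤ 2 (≤-trans (m≤n+m∸n (suc k C 2) 1) (s≤s kC2∸1≤n)) ⟩
  2 * suc n        ∎
  where open ≤-Reasoning

[m+n]*[m+n]≤m*m+2*[m+n]*n : ∀ m n → (m + n) * (m + n) ≤ m * m + 2 * (m + n) * n
[m+n]*[m+n]≤m*m+2*[m+n]*n m n =
  subst ((m + n) * (m + n) ≤_) (ring m n) (m≤m+n ((m + n) * (m + n)) (n * n))
  where
  ring : ∀ m n → (m + n) * (m + n) + n * n ≡ m * m + 2 * (m + n) * n
  ring = solve-∀

m*m≤[m∸n]*[m∸n]+2*m*n : ∀ m n → m * m ≤ (m ∸ n) * (m ∸ n) + 2 * m * n
m*m≤[m∸n]*[m∸n]+2*m*n m n with n ≤? m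
... | yes n≤m = subst (λ x → x * x ≤ (m ∸ n) * (m ∸ n) + 2 * x * n) (m∸n+n≡m n≤m)
                  ([m+n]*[m+n]≤m*m+2*[m+n]*n (m ∸ n) n)
... | no  n≰m rewrite m≤n⇒m∸n≡0 (<⇒≤ (≰⇒> n≰m)) =
  ≤-trans (*-monoʳ-≤ m (<⇒≤ (≰⇒> n≰m))) (*-monoˡ-≤ n (m≤m+n m (m + 0)))

m^2∸2*o≤2+2*m*n : ∀ {m n o} → (m ∸ n) * (m ∸ n) ≤ 2 * suc o → m ^ 2 ∸ 2 * o ≤ 2 + 2 * m * n
m^2∸2*o≤2+2*m*n {m} {n} {o} [m∸n]²≤ = m≤n+o⇒m∸n≤o (m ^ 2) (2 * o) (begin
  m ^ 2                          ≡⟨ cong (m *_) (*-identityʳ m) ⟩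
  m * m                          ≤⟨ m*m≤[m∸n]*[m∸n]+2*m*n m n ⟩
  (m ∸ n) * (m ∸ n) + 2 * m * n  ≤⟨ +-monoˡ-≤ (2 * m * n) [m∸n]²≤ ⟩
  2 * suc o + 2 * m * n          ≡⟨ ring o (2 * m * n) ⟩
  2 * o + (2 + 2 * m * n)        ∎)
  where
  open ≤-Reasoning
  ring : ∀ o x → 2 * suc o + x ≡ 2 * o + (2 + x)
  ring = solve-∀

2+2*m*[3*[2*[1+n]]]≤26*[m*n] : ∀ {m n} → 1 ≤ m → 1 ≤ n → 2 + 2 * m * (3 * (2 * suc n)) ≤ 26 * (m * n)
2+2*m*[3*[2*[1+n]]]≤26*[m*n] {suc m} {suc n} _ _ =
  subst (2 + 2 * suc m * (3 * (2 * suc (suc n))) ≤_) (ring m n) (m≤m+n _ (14 * m * n + 2 * m + 14 * n))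
  where
  ring : ∀ m n → 2 + 2 * suc m * (3 * (2 * suc (suc n))) + (14 * m * n + 2 * m + 14 * n)
               ≡ 26 * (suc m * suc n)
  ring = solve-∀

m≤26*[n*b]⇒m^2≤4*13^2*n^3 : ∀ {m n b} → m ≤ 26 * (n * b) → b * b ≤ n → m ^ 2 ≤ 4 * 13 ^ 2 * n ^ 3
m≤26*[n*b]⇒m^2≤4*13^2*n^3 {m} {n} {b} m≤ b*b≤n = begin
  m ^ 2                    ≤⟨ ^-monoˡ-≤ 2 m≤ ⟩
  (26 * (n * b)) ^ 2       ≡⟨ ring₁ n b ⟩
  676 * (n * n * (b * b))  ≤⟨ *-monoʳ-≤ 676 (*-monoʳ-≤ (n * n) b*b≤n) ⟩
  676 * (n * n * n)        ≡⟨ cong (676 *_) (ring₂ n) ⟩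
  4 * 13 ^ 2 * n ^ 3       ∎
  where
  open ≤-Reasoning
  ring₁ : ∀ n b → 26 * (n * b) * (26 * (n * b) * 1) ≡ 676 * (n * n * (b * b))
  ring₁ = solve-∀
  ring₂ : ∀ n → n * n * n ≡ n * (n * (n * 1))
  ring₂ = solve-∀

floor-sqrt : ∀ n → ∃[ b ] b * b ≤ n × n < suc b * suc b
floor-sqrt zero = 0 , z≤n , s≤s z≤n
floor-sqrt (suc n) with floor-sqrt n
... | b , b*b≤n , n<[1+b]² with m≤n⇒m<n∨m≡n n<[1+b]²
...   | inj₁ 1+n<[1+b]² = b , m≤n⇒m≤1+n b*b≤n , 1+n<[1+b]²
...   | inj₂ 1+n≡[1+b]² = suc b , ≤-reflexive (sym 1+n≡[1+b]²) ,
                          subst (_< suc (suc b) * suc (suc b)) (sym 1+n≡[1+b]²)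
                                (*-mono-< (n<1+n (suc b)) (n<1+n (suc b)))

mainTheorem7 : ∃ λ (c : ℕ) → 0 < c × (∀ (n N : ℕ) → 1 ≤ n → IsH n N → (n ^ 2 ∸ 2 * N) ^ 2 ≤ 4 * c ^ 2 * n ^ 3)
mainTheorem7 = 13 , s≤s z≤n , H-bound
  where
  H-bound : ∀ n N → 1 ≤ n → IsH n N → (n ^ 2 ∸ 2 * N) ^ 2 ≤ 4 * 13 ^ 2 * n ^ 3
  H-bound n N 1≤n (_ , H-maximal) with floor-sqrt n
  ... | zero , _ , n<1 = ⊥-elim (<⇒≱ 1≤n (s≤s⁻¹ n<1))
  ... | b@(suc _) , b*b≤n , n<[1+b]² = m≤26*[n*b]⇒m^2≤4*13^2*n^3 defect≤ b*b≤n
    where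
    L = 2 * suc b
    K<[1+L]C2 : n ∸ 3 * L < suc L C 2
    K<[1+L]C2 = <-≤-trans (≤-<-trans (m∸n≤m n (3 * L)) n<[1+b]²) (n*n≤[1+2*n]C2 (suc b))
    K*K≤ : (n ∸ 3 * L) * (n ∸ 3 * L) ≤ 2 * suc N
    K*K≤ = [1+k]C2∸1≤n⇒k*k≤2*[1+n] {n ∸ 3 * L} (H-maximal _ (allGood-[1+n∸3*L]C2∸1 n L K<[1+L]C2))
    defect≤ : n ^ 2 ∸ 2 * N ≤ 26 * (n * b)
    defect≤ = ≤-trans (m^2∸2*o≤2+2*m*n {n} {3 * L} {N} K*K≤)
                      (2+2*m*[3*[2*[1+n]]]≤26*[m*n] {n} {b} 1≤n (s≤s z≤n))
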